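{- Let $T$ be a linear operator on an $md$-dimensional vector space $V$ over $\mathbb{F}_q$, let $c\in\mathbb{F}_q$, and let $I$ be the identity on $V$. Then $\sigma(m,d;T)=\sigma(m,d;T+cI)$.
   Context: An $m$-dimensional subspace $W$ of $V$ is $T$-splitting if $V=W\oplus TW\oplus\cdots\oplus T^{d-1}W$; $\sigma(m,d;T)$ is the number of $m$-dimensional $T$-splitting subspaces. -}

module Defs where

open import Data.Nat using (ℕ; zero; suc; _*_)
open import Data.Fin using (Fin; toℕ) renaming (zero to fzero; suc to fsuc)
open import Data.Vec using (Vec; zipWith; map; replicate)
open import Data.Bool using (Bool; true)
open import Data.Product using (Σ; ∃; _×_)
open import Relation.Binary.PropositionalEquality using (_≡_; _≢_)
open import Relation.Nullary using (¬_)
open import Algebra.Structures using (IsCommutativeRing)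

record FiniteField (q : ℕ) : Set where
  field
    _+F_ _*F_ : Fin q → Fin q → Fin q
    -F_       : Fin q → Fin q
    0F 1F     : Fin q
    isCommutativeRing : IsCommutativeRing _≡_ _+F_ _*F_ -F_ 0F 1F
    0≢1       : 0F ≢ 1F
    inverse   : ∀ x → x ≢ 0F → Σ (Fin q) (λ y → x *F y ≡ 1F)

module _ {q : ℕ} (𝔽 : FiniteField q) where
  open FiniteField 𝔽

  Vect : ℕ → Set
  Vect n = Vec (Fin q) n

  _⊕_ : ∀ {n} → Vect n → Vect n → Vect n
  u ⊕ v = zipWith _+F_ u v

  _·_ : ∀ {n} → Fin q → Vect n → Vect n
  c · v = map (c *F_) v

  𝟎 : ∀ {n} → Vect n
  𝟎 = replicate _ 0F

  IsLinear : ∀ {n} → (Vect n → Vect n) → Set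
  IsLinear T = (∀ u v → T (u ⊕ v) ≡ T u ⊕ T v) × (∀ c v → T (c · v) ≡ c · T v)

  plusScalar : ∀ {n} → (Vect n → Vect n) → Fin q → (Vect n → Vect n)
  plusScalar T c v = T v ⊕ (c · v)

  iter : ∀ {n} → (Vect n → Vect n) → ℕ → Vect n → Vect n
  iter T zero v = v
  iter T (suc k) v = T (iter T k v)

  lincomb : ∀ {n k} → (Fin k → Fin q) → (Fin k → Vect n) → Vect n
  lincomb {k = zero} c b = 𝟎
  lincomb {k = suc k} c b = (c fzero · b fzero) ⊕ lincomb (λ i → c (fsuc i)) (λ i → b (fsuc i))

  vsum : ∀ {n k} → (Fin k → Vect n) → Vect n
  vsum {k = zero} v = 𝟎
  vsum {k = suc k} v = v fzero ⊕ vsum (λ i → v (fsuc i))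

  Subset : ℕ → Set
  Subset n = Vect n → Bool

  _∈_ : ∀ {n} → Vect n → Subset n → Set
  v ∈ W = W v ≡ true

  IsSubspace : ∀ {n} → Subset n → Set
  IsSubspace W = (𝟎 ∈ W) × (∀ u v → u ∈ W → v ∈ W → (u ⊕ v) ∈ W)
                 × (∀ c v → v ∈ W → (c · v) ∈ W)

  IsBasis : ∀ {n m} → Subset n → (Fin m → Vect n) → Set
  IsBasis {m = m} W b = (∀ i → b i ∈ W)
                × (∀ v → v ∈ W → Σ (Fin m → Fin q) (λ c → lincomb c b ≡ v))
                × (∀ c → lincomb c b ≡ 𝟎 → ∀ i → c i ≡ 0F)

  IsSubspaceOfDim : ∀ {n} → ℕ → Subset n → Set
  IsSubspaceOfDim {n} m W = IsSubspace W × Σ (Fin m → Vect n) (λ b → IsBasis W b)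

  -- W is an m-dimensional T-splitting subspace of V (dim V = m d):
  -- V = W ⊕ TW ⊕ ... ⊕ T^{d-1} W  (internal direct sum: every vector is a
  -- sum Σ_{k<d} T^k w_k with w_k ∈ W, and the components T^k w_k are unique).
  IsSplitting : (m d : ℕ) → (Vect (m * d) → Vect (m * d)) → Subset (m * d) → Set
  IsSplitting m d T W =
    IsSubspaceOfDim m W
    × (∀ v → Σ (Fin d → Vect (m * d)) (λ w →
          (∀ k → w k ∈ W) × vsum (λ k → iter T (toℕ k) (w k)) ≡ v))
    × (∀ (w w' : Fin d → Vect (m * d)) → (∀ k → w k ∈ W) → (∀ k → w' k ∈ W)
          → vsum (λ k → iter T (toℕ k) (w k)) ≡ vsum (λ k → iter T (toℕ k) (w' k))
          → ∀ k → iter T (toℕ k) (w k) ≡ iter T (toℕ k) (w' k))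

  _≐_ : ∀ {n} → Subset n → Subset n → Set
  W ≐ W' = ∀ v → W v ≡ W' v

  -- "The number of subsets W satisfying P is k" (subsets counted up to
  -- extensional equality): an exhaustive list of k pairwise distinct such W.
  HasCard : ∀ {n} → (Subset n → Set) → ℕ → Set
  HasCard {n} P k = Σ (Fin k → Subset n) (λ L →
      (∀ i j → i ≢ j → ¬ (L i ≐ L j))
    × (∀ i → P (L i))
    × (∀ W → P W → ∃ (λ i → W ≐ L i)))

  σ≡ : (m d : ℕ) → (Vect (m * d) → Vect (m * d)) → ℕ → Set
  σ≡ m d T k = HasCard (IsSplitting m d T) k

{-# OPTIONS --safe #-}
-- A subspace W of dimension m is T-splitting as soon as W + TW + ⋯ + T^{d-1}W = V:
-- writing each component in W through a spanning m-tuple of W gives a map F_q^{md} → V,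
-- which is then a surjection between sets of the same size q^{md}, hence a bijection,
-- and this is exactly the directness of the sum. The sum itself depends
-- only on the span of W, TW, …, T^{d-1}W, and this span is the same for T and
-- T + cI, since T^j = ((T + cI) − cI)^j is a combination of the (T + cI)^i, i ≤ j.
module Submission where

open import Defs hiding (_⊕_; _·_; 𝟎; _∈_; iter; vsum; lincomb)
import Defs
open import Data.Nat using (ℕ; _*_; _^_; zero; suc; _<_; _≤_; z≤n; s≤s)
open import Data.Nat.Properties using (n≮n; m≤n⇒m≤1+n; ≤-<-trans)
open import Data.Fin using (Fin; toℕ; fromℕ<; combine; remQuot; punchIn; punchOut; finToFun; funToFin)
  renaming (zero to fzero; suc to fsuc)
open import Data.Fin.Properties
  using (_≟_; suc-injective; injective⇒≤; punchIn-punchOut; toℕ<n; toℕ-fromℕ<; remQuot-combine;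
         finToFun-funToFin; funToFin-finToFin)
open import Data.Vec using (Vec; []; _∷_; lookup; tabulate; replicate)
open import Data.Vec.Functional using (updateAt)
open import Data.Vec.Functional.Properties using (updateAt-updates; updateAt-minimal)
open import Data.Vec.Properties
  using (zipWith-assoc; zipWith-identityˡ; zipWith-identityʳ; map-replicate;
         map-cong; map-const; tabulate-cong; tabulate∘lookup; lookup∘tabulate)
open import Data.Product using (_×_; _,_; Σ; proj₁; proj₂)
open import Function.Base using (_∘_)
open import Function.Bundles using (_↔_; mk↔ₛ′; Inverse)
open import Function.Definitions using (Injective; StrictlySurjective)
open import Relation.Binary.PropositionalEquality
open import Relation.Nullary using (yes; no; contradiction)
open import Algebra.Bundles using (CommutativeSemigroup)
open import Algebra.Structures using (IsCommutativeRing)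
import Algebra.Properties.CommutativeSemigroup as CommutativeSemigroupProperties

private
  variable
    A : Set
    n : ℕ

surjective⇒injective : (f : Fin n → Fin n) → StrictlySurjective _≡_ f → Injective _≡_ _≡_ f
surjective⇒injective {zero}  f surj {()}
surjective⇒injective {suc n} f surj {i} {j} fi≡fj with i ≟ j
... | yes i≡j = i≡j
... | no  i≢j = contradiction (injective⇒≤ section-injective) (n≮n n)
  where
    -- f ∘ punchIn j still hits every point (f j = f i), so it has a section Fin (suc n) → Fin n.
    f∘punchIn-surjective : StrictlySurjective _≡_ (f ∘ punchIn j)
    f∘punchIn-surjective y with surj y
    ... | x , fx≡y with x ≟ j
    ...   | yes refl = punchOut (i≢j ∘ sym) , trans (cong f (punchIn-punchOut (i≢j ∘ sym))) (trans fi≡fj fx≡y)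
    ...   | no  x≢j  = punchOut (x≢j ∘ sym) , trans (cong f (punchIn-punchOut (x≢j ∘ sym))) fx≡y

    section-injective : Injective _≡_ _≡_ (proj₁ ∘ f∘punchIn-surjective)
    section-injective {a} {b} eq =
      trans (sym (proj₂ (f∘punchIn-surjective a)))
            (trans (cong (f ∘ punchIn j) eq) (proj₂ (f∘punchIn-surjective b)))

↔Fin-surjective⇒injective : A ↔ Fin n → (f : A → A) → StrictlySurjective _≡_ f → Injective _≡_ _≡_ f
↔Fin-surjective⇒injective A↔Fin f surj {a} {b} fa≡fb = begin
  a            ≡⟨ strictlyInverseʳ a ⟨
  from (to a)  ≡⟨ cong from (g-injective (begin
    to (f (from (to a)))  ≡⟨ cong (to ∘ f) (strictlyInverseʳ a) ⟩
    to (f a)              ≡⟨ cong to fa≡fb ⟩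
    to (f b)              ≡⟨ cong (to ∘ f) (strictlyInverseʳ b) ⟨
    to (f (from (to b)))  ∎)) ⟩
  from (to b)  ≡⟨ strictlyInverseʳ b ⟩
  b            ∎
  where
    open ≡-Reasoning
    open Inverse A↔Fin
    g-surjective : StrictlySurjective _≡_ (to ∘ f ∘ from)
    g-surjective y with surj (from y)
    ... | x , fx≡y = to x , trans (cong (to ∘ f) (strictlyInverseʳ x)) (trans (cong to fx≡y) (strictlyInverseˡ y))
    g-injective : Injective _≡_ _≡_ (to ∘ f ∘ from)
    g-injective = surjective⇒injective (to ∘ f ∘ from) g-surjective

funToFin-cong : ∀ {m k} {f g : Fin m → Fin k} → (∀ i → f i ≡ g i) → funToFin f ≡ funToFin g
funToFin-cong {zero}  f≗g = refl
funToFin-cong {suc m} f≗g = cong₂ combine (f≗g fzero) (funToFin-cong (f≗g ∘ fsuc))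

Vec-Fin↔Fin^ : ∀ {q} → Vec (Fin q) n ↔ Fin (q ^ n)
Vec-Fin↔Fin^ {n} {q} = mk↔ₛ′ (funToFin ∘ lookup) (tabulate ∘ finToFun)
  (λ i → trans (funToFin-cong (lookup∘tabulate (finToFun {q} {n} i))) (funToFin-finToFin {n} {q} i))
  (λ v → trans (tabulate-cong (finToFun-funToFin (lookup v))) (tabulate∘lookup v))

HasCard-cong : ∀ {q} (𝔽 : FiniteField q) {P Q : Subset 𝔽 n → Set} →
               (∀ W → P W → Q W) → (∀ W → Q W → P W) → ∀ k → HasCard 𝔽 P k → HasCard 𝔽 Q k
HasCard-cong 𝔽 P⇒Q Q⇒P k (L , distinct , P-L , complete) =
  L , distinct , (λ i → P⇒Q (L i) (P-L i)) , (λ W QW → complete W (Q⇒P W QW))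

module _ {q : ℕ} (𝔽 : FiniteField q) where
  open FiniteField 𝔽
  open IsCommutativeRing isCommutativeRing
    using (+-assoc; +-identityˡ; +-identityʳ; *-assoc; *-comm; distribˡ; distribʳ;
           zeroˡ; zeroʳ; -‿inverseʳ; +-isCommutativeSemigroup)

  +-commutativeSemigroup : CommutativeSemigroup _ _
  +-commutativeSemigroup = record
    { Carrier = Fin q ; _≈_ = _≡_ ; _∙_ = _+F_ ; isCommutativeSemigroup = +-isCommutativeSemigroup }

  open CommutativeSemigroupProperties +-commutativeSemigroup using (interchange)

  infixl 6 _⊕_
  infixr 7 _·_
  infix 4 _∈_

  V : ℕ → Set
  V = Vect 𝔽

  _⊕_ : V n → V n → V n
  _⊕_ = Defs._⊕_ 𝔽

  _·_ : Fin q → V n → V n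
  _·_ = Defs._·_ 𝔽

  𝟎 : V n
  𝟎 = Defs.𝟎 𝔽

  _∈_ : V n → Subset 𝔽 n → Set
  _∈_ = Defs._∈_ 𝔽

  iter : (V n → V n) → ℕ → V n → V n
  iter = Defs.iter 𝔽

  vsum : ∀ {d} → (Fin d → V n) → V n
  vsum = Defs.vsum 𝔽

  lincomb : ∀ {m} → (Fin m → Fin q) → (Fin m → V n) → V n
  lincomb = Defs.lincomb 𝔽

  ⊕-assoc : (u v w : V n) → u ⊕ v ⊕ w ≡ u ⊕ (v ⊕ w)
  ⊕-assoc = zipWith-assoc +-assoc

  ⊕-identityˡ : (v : V n) → 𝟎 ⊕ v ≡ v
  ⊕-identityˡ = zipWith-identityˡ +-identityˡ

  ⊕-identityʳ : (v : V n) → v ⊕ 𝟎 ≡ v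
  ⊕-identityʳ = zipWith-identityʳ +-identityʳ

  ⊕-interchange : (u v w x : V n) → (u ⊕ v) ⊕ (w ⊕ x) ≡ (u ⊕ w) ⊕ (v ⊕ x)
  ⊕-interchange []      []      []      []      = refl
  ⊕-interchange (a ∷ u) (b ∷ v) (c ∷ w) (e ∷ x) = cong₂ _∷_ (interchange a b c e) (⊕-interchange u v w x)

  ·-zeroˡ : (v : V n) → 0F · v ≡ 𝟎
  ·-zeroˡ v = trans (map-cong zeroˡ v) (map-const v 0F)

  ·-zeroʳ : ∀ c → c · 𝟎 {n} ≡ 𝟎
  ·-zeroʳ {n} c = trans (map-replicate (c *F_) 0F n) (cong (replicate n) (zeroʳ c))

  ·-distribˡ-⊕ : ∀ c (u v : V n) → c · (u ⊕ v) ≡ c · u ⊕ c · v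
  ·-distribˡ-⊕ c []      []      = refl
  ·-distribˡ-⊕ c (a ∷ u) (b ∷ v) = cong₂ _∷_ (distribˡ c a b) (·-distribˡ-⊕ c u v)

  ·-distribʳ-+ : ∀ a b (v : V n) → (a +F b) · v ≡ a · v ⊕ b · v
  ·-distribʳ-+ a b []      = refl
  ·-distribʳ-+ a b (x ∷ v) = cong₂ _∷_ (distribʳ x a b) (·-distribʳ-+ a b v)

  ·-comm : ∀ a b (v : V n) → a · b · v ≡ b · a · v
  ·-comm a b []      = refl
  ·-comm a b (x ∷ v) =
    cong₂ _∷_ (trans (sym (*-assoc a b x)) (trans (cong (_*F x) (*-comm a b)) (*-assoc b a x))) (·-comm a b v)

  Linear : (V n → V n) → Set
  Linear = IsLinear 𝔽

  linear-𝟎 : {S : V n → V n} → Linear S → S 𝟎 ≡ 𝟎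
  linear-𝟎 {S = S} (_ , S-· ) = begin
    S 𝟎         ≡⟨ cong S (sym (·-zeroˡ 𝟎)) ⟩
    S (0F · 𝟎)  ≡⟨ S-· 0F 𝟎 ⟩
    0F · S 𝟎    ≡⟨ ·-zeroˡ (S 𝟎) ⟩
    𝟎           ∎
    where open ≡-Reasoning

  iter-⊕ : {S : V n → V n} → Linear S → ∀ k u v → iter S k (u ⊕ v) ≡ iter S k u ⊕ iter S k v
  iter-⊕ lin zero    u v = refl
  iter-⊕ {S = S} lin (suc k) u v = trans (cong S (iter-⊕ lin k u v)) (proj₁ lin _ _)

  iter-· : {S : V n → V n} → Linear S → ∀ k c v → iter S k (c · v) ≡ c · iter S k v
  iter-· lin zero    c v = refl
  iter-· {S = S} lin (suc k) c v = trans (cong S (iter-· lin k c v)) (proj₂ lin _ _)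

  iter-𝟎 : {S : V n → V n} → Linear S → ∀ k → iter S k 𝟎 ≡ 𝟎
  iter-𝟎 lin zero    = refl
  iter-𝟎 {S = S} lin (suc k) = trans (cong S (iter-𝟎 lin k)) (linear-𝟎 lin)

  plusScalar-linear : {T : V n → V n} → Linear T → ∀ c → Linear (plusScalar 𝔽 T c)
  plusScalar-linear {T = T} (T-⊕ , T-·) c =
    (λ u v → trans (cong₂ _⊕_ (T-⊕ u v) (·-distribˡ-⊕ c u v)) (⊕-interchange (T u) (T v) (c · u) (c · v))) ,
    (λ a v → trans (cong₂ _⊕_ (T-· a v) (·-comm c a v)) (sym (·-distribˡ-⊕ a (T v) (c · v))))

  plusScalar-minus : ∀ (T : V n → V n) c x → T x ≡ plusScalar 𝔽 T c x ⊕ (-F c) · x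
  plusScalar-minus T c x = sym (begin
    T x ⊕ c · x ⊕ (-F c) · x    ≡⟨ ⊕-assoc (T x) _ _ ⟩
    T x ⊕ (c · x ⊕ (-F c) · x)  ≡⟨ cong (T x ⊕_) (sym (·-distribʳ-+ c (-F c) x)) ⟩
    T x ⊕ (c +F (-F c)) · x     ≡⟨ cong (λ a → T x ⊕ a · x) (-‿inverseʳ c) ⟩
    T x ⊕ 0F · x                ≡⟨ cong (T x ⊕_) (·-zeroˡ x) ⟩
    T x ⊕ 𝟎                     ≡⟨ ⊕-identityʳ (T x) ⟩
    T x                         ∎)
    where open ≡-Reasoning

  vsum-cong : ∀ {d} {u v : Fin d → V n} → (∀ k → u k ≡ v k) → vsum u ≡ vsum v
  vsum-cong {d = zero}  u≗v = refl
  vsum-cong {d = suc d} u≗v = cong₂ _⊕_ (u≗v fzero) (vsum-cong (u≗v ∘ fsuc))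

  vsum-𝟎 : ∀ {d} (v : Fin d → V n) → (∀ k → v k ≡ 𝟎) → vsum v ≡ 𝟎
  vsum-𝟎 {d = zero}  v v≗𝟎 = refl
  vsum-𝟎 {d = suc d} v v≗𝟎 = trans (cong₂ _⊕_ (v≗𝟎 fzero) (vsum-𝟎 _ (v≗𝟎 ∘ fsuc))) (⊕-identityˡ 𝟎)

  vsum-⊕ : ∀ {d} (u v : Fin d → V n) → vsum (λ k → u k ⊕ v k) ≡ vsum u ⊕ vsum v
  vsum-⊕ {d = zero}  u v = sym (⊕-identityˡ 𝟎)
  vsum-⊕ {d = suc d} u v =
    trans (cong (u fzero ⊕ v fzero ⊕_) (vsum-⊕ (u ∘ fsuc) (v ∘ fsuc))) (⊕-interchange _ _ _ _)

  vsum-· : ∀ {d} c (v : Fin d → V n) → vsum (λ k → c · v k) ≡ c · vsum v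
  vsum-· {d = zero}  c v = sym (·-zeroʳ c)
  vsum-· {d = suc d} c v = trans (cong (c · v fzero ⊕_) (vsum-· c (v ∘ fsuc))) (sym (·-distribˡ-⊕ c _ _))

  vsum-single : ∀ {d} (j : Fin d) (v : Fin d → V n) → (∀ k → k ≢ j → v k ≡ 𝟎) → vsum v ≡ v j
  vsum-single fzero    v vanish =
    trans (cong (v fzero ⊕_) (vsum-𝟎 _ (λ k → vanish (fsuc k) λ ()))) (⊕-identityʳ (v fzero))
  vsum-single (fsuc j) v vanish =
    trans (cong (_⊕ vsum (v ∘ fsuc)) (vanish fzero λ ()))
          (trans (⊕-identityˡ _) (vsum-single j (v ∘ fsuc) (λ k k≢j → vanish (fsuc k) (k≢j ∘ suc-injective))))

  lincomb-cong : ∀ {m} {c c′ : Fin m → Fin q} (b : Fin m → V n) →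
                 (∀ j → c j ≡ c′ j) → lincomb c b ≡ lincomb c′ b
  lincomb-cong {m = zero}  b c≗c′ = refl
  lincomb-cong {m = suc m} b c≗c′ =
    cong₂ _⊕_ (cong (_· b fzero) (c≗c′ fzero)) (lincomb-cong (b ∘ fsuc) (c≗c′ ∘ fsuc))

  powerSum : ∀ {d} → (V n → V n) → (Fin d → V n) → V n
  powerSum S w = vsum (λ k → iter S (toℕ k) (w k))

  powerSum-cong : ∀ {d} (S : V n → V n) {u v : Fin d → V n} → (∀ k → u k ≡ v k) → powerSum S u ≡ powerSum S v
  powerSum-cong S u≗v = vsum-cong (λ k → cong (iter S (toℕ k)) (u≗v k))

  module _ {S : V n → V n} (S-linear : Linear S) {d : ℕ} where

    powerSum-𝟎 : powerSum {d = d} S (λ _ → 𝟎) ≡ 𝟎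
    powerSum-𝟎 = vsum-𝟎 {d = d} (λ k → iter S (toℕ k) 𝟎) (λ k → iter-𝟎 S-linear (toℕ k))

    powerSum-⊕ : (u v : Fin d → V n) → powerSum S (λ k → u k ⊕ v k) ≡ powerSum S u ⊕ powerSum S v
    powerSum-⊕ u v = trans (vsum-cong (λ k → iter-⊕ S-linear (toℕ k) (u k) (v k)))
                           (vsum-⊕ (λ k → iter S (toℕ k) (u k)) (λ k → iter S (toℕ k) (v k)))

    powerSum-· : ∀ c (v : Fin d → V n) → powerSum S (λ k → c · v k) ≡ c · powerSum S v
    powerSum-· c v = trans (vsum-cong (λ k → iter-· S-linear (toℕ k) c (v k)))
                           (vsum-· c (λ k → iter S (toℕ k) (v k)))

  Decomposes : ℕ → (V n → V n) → Subset 𝔽 n → V n → Set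
  Decomposes {n} d S W v = Σ (Fin d → V n) (λ w → (∀ k → w k ∈ W) × powerSum S w ≡ v)

  Spans : ℕ → (V n → V n) → Subset 𝔽 n → Set
  Spans d S W = ∀ v → Decomposes d S W v

  Direct : ℕ → (V n → V n) → Subset 𝔽 n → Set
  Direct {n} d S W = ∀ (w w′ : Fin d → V n) → (∀ k → w k ∈ W) → (∀ k → w′ k ∈ W)
    → powerSum S w ≡ powerSum S w′ → ∀ k → iter S (toℕ k) (w k) ≡ iter S (toℕ k) (w′ k)

  module _ {S : V n → V n} (S-linear : Linear S) {W : Subset 𝔽 n} (W-subspace : IsSubspace 𝔽 W) {d : ℕ} where
    private
      𝟎∈W : 𝟎 ∈ W
      𝟎∈W = proj₁ W-subspace
      ⊕-closed : ∀ {u v} → u ∈ W → v ∈ W → u ⊕ v ∈ W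
      ⊕-closed {u} {v} = proj₁ (proj₂ W-subspace) u v
      ·-closed : ∀ c {v} → v ∈ W → c · v ∈ W
      ·-closed c {v} = proj₂ (proj₂ W-subspace) c v

    Decomposes-𝟎 : Decomposes d S W 𝟎
    Decomposes-𝟎 = (λ _ → 𝟎) , (λ _ → 𝟎∈W) , powerSum-𝟎 S-linear {d}

    Decomposes-⊕ : ∀ {u v} → Decomposes d S W u → Decomposes d S W v → Decomposes d S W (u ⊕ v)
    Decomposes-⊕ (w , w∈W , Σw≡u) (w′ , w′∈W , Σw′≡v) =
      (λ k → w k ⊕ w′ k) , (λ k → ⊕-closed (w∈W k) (w′∈W k)) ,
      trans (powerSum-⊕ S-linear w w′) (cong₂ _⊕_ Σw≡u Σw′≡v)

    Decomposes-· : ∀ c {v} → Decomposes d S W v → Decomposes d S W (c · v)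
    Decomposes-· c (w , w∈W , Σw≡v) =
      (λ k → c · w k) , (λ k → ·-closed c (w∈W k)) , trans (powerSum-· S-linear c w) (cong (c ·_) Σw≡v)

    Decomposes-vsum : ∀ {e} (v : Fin e → V n) → (∀ i → Decomposes d S W (v i)) → Decomposes d S W (vsum v)
    Decomposes-vsum {e = zero}  v dec = Decomposes-𝟎
    Decomposes-vsum {e = suc e} v dec = Decomposes-⊕ (dec fzero) (Decomposes-vsum (v ∘ fsuc) (dec ∘ fsuc))

    Decomposes-iter : ∀ (j : Fin d) {x} → x ∈ W → Decomposes d S W (iter S (toℕ j) x)
    Decomposes-iter j {x} x∈W =
      w , w∈W , trans (vsum-single j _ vanish) (cong (iter S (toℕ j)) (updateAt-updates j _))
      where
        w : Fin d → V n
        w = updateAt (λ _ → 𝟎) j (λ _ → x)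
        w∈W : ∀ k → w k ∈ W
        w∈W k with k ≟ j
        ... | yes refl = subst (_∈ W) (sym (updateAt-updates j _)) x∈W
        ... | no  k≢j  = subst (_∈ W) (sym (updateAt-minimal k j _ k≢j)) 𝟎∈W
        vanish : ∀ k → k ≢ j → iter S (toℕ k) (w k) ≡ 𝟎
        vanish k k≢j = trans (cong (iter S (toℕ k)) (updateAt-minimal k j _ k≢j)) (iter-𝟎 S-linear (toℕ k))

  data Span≤ {n} (S : V n → V n) (W : Subset 𝔽 n) (b : ℕ) : V n → Set where
    iter-∈ : ∀ {j x} → j ≤ b → x ∈ W → Span≤ S W b (iter S j x)
    𝟎-∈    : Span≤ S W b 𝟎
    ⊕-∈    : ∀ {u v} → Span≤ S W b u → Span≤ S W b v → Span≤ S W b (u ⊕ v)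
    ·-∈    : ∀ c {v} → Span≤ S W b v → Span≤ S W b (c · v)

  module _ {T S : V n → V n} (T-linear : Linear T) (e : Fin q) (T≡S+e : ∀ x → T x ≡ S x ⊕ e · x)
           {W : Subset 𝔽 n} where

    Span≤-step : ∀ {b v} → Span≤ S W b v → Span≤ S W (suc b) (T v)
    Span≤-step (iter-∈ {j} {x} j≤b x∈W) = subst (Span≤ S W _) (sym (T≡S+e (iter S j x)))
      (⊕-∈ (iter-∈ (s≤s j≤b) x∈W) (·-∈ e (iter-∈ (m≤n⇒m≤1+n j≤b) x∈W)))
    Span≤-step 𝟎-∈       = subst (Span≤ S W _) (sym (linear-𝟎 T-linear)) 𝟎-∈
    Span≤-step (⊕-∈ u v) = subst (Span≤ S W _) (sym (proj₁ T-linear _ _)) (⊕-∈ (Span≤-step u) (Span≤-step v))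
    Span≤-step (·-∈ c v) = subst (Span≤ S W _) (sym (proj₂ T-linear _ _)) (·-∈ c (Span≤-step v))

    iter-Span≤ : ∀ {x} → x ∈ W → ∀ b → Span≤ S W b (iter T b x)
    iter-Span≤ x∈W zero    = iter-∈ z≤n x∈W
    iter-Span≤ x∈W (suc b) = Span≤-step (iter-Span≤ x∈W b)

  Span≤⇒Decomposes : {S : V n → V n} → Linear S → {W : Subset 𝔽 n} → IsSubspace 𝔽 W →
                     ∀ {b d v} → Span≤ S W b v → b < d → Decomposes d S W v
  Span≤⇒Decomposes {S = S} S-lin {W} W-sub {d = d} (iter-∈ {j} {x} j≤b x∈W) b<d =
    subst (λ i → Decomposes d S W (iter S i x)) (toℕ-fromℕ< j<d)
          (Decomposes-iter S-lin W-sub (fromℕ< j<d) x∈W)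
    where
      j<d : j < d
      j<d = ≤-<-trans j≤b b<d
  Span≤⇒Decomposes S-lin W-sub 𝟎-∈       b<d = Decomposes-𝟎 S-lin W-sub
  Span≤⇒Decomposes S-lin W-sub (⊕-∈ u v) b<d =
    Decomposes-⊕ S-lin W-sub (Span≤⇒Decomposes S-lin W-sub u b<d) (Span≤⇒Decomposes S-lin W-sub v b<d)
  Span≤⇒Decomposes S-lin W-sub (·-∈ c v) b<d = Decomposes-· S-lin W-sub c (Span≤⇒Decomposes S-lin W-sub v b<d)

  Spans-transfer : {T S : V n → V n} → Linear T → Linear S → ∀ e → (∀ x → T x ≡ S x ⊕ e · x) →
                   {W : Subset 𝔽 n} → IsSubspace 𝔽 W → ∀ {d} → Spans d T W → Spans d S W
  Spans-transfer {T = T} {S} T-lin S-lin e T≡S+e {W} W-sub {d} T-spans v with T-spans v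
  ... | w , w∈W , Σw≡v = subst (Decomposes d S W) Σw≡v
    (Decomposes-vsum S-lin W-sub (λ k → iter T (toℕ k) (w k)) λ k →
       Span≤⇒Decomposes S-lin W-sub (iter-Span≤ T-lin e T≡S+e (w∈W k) (toℕ k)) (toℕ<n k))

  module _ {m d : ℕ} {S : V (m * d) → V (m * d)} {W : Subset 𝔽 (m * d)} (b : Fin m → V (m * d))
           (b-spans : ∀ v → v ∈ W → Σ (Fin m → Fin q) (λ c → lincomb c b ≡ v)) where

    -- A vector of length m d read as d blocks of m coefficients, one block per power of S.
    block : V (m * d) → Fin d → Fin m → Fin q
    block a k j = lookup a (combine j k)

    assemble : V (m * d) → V (m * d)
    assemble a = powerSum S (λ k → lincomb (block a k) b)

    coefficients : (w : Fin d → V (m * d)) → (∀ k → w k ∈ W) →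
                   Σ (V (m * d)) (λ a → ∀ k → lincomb (block a k) b ≡ w k)
    coefficients w w∈W = tabulate (λ i → let (j , k) = remQuot d i in c k j) , λ k →
      trans (lincomb-cong b (λ j → trans (lookup∘tabulate _ (combine j k))
                                          (cong (λ (j , k) → c k j) (remQuot-combine j k))))
            (proj₂ (b-spans (w k) (w∈W k)))
      where
        c : Fin d → Fin m → Fin q
        c k = proj₁ (b-spans (w k) (w∈W k))

    Spans⇒Direct : Spans d S W → Direct d S W
    Spans⇒Direct S-spans w w′ w∈W w′∈W Σw≡Σw′ k with coefficients w w∈W | coefficients w′ w′∈W
    ... | a , a≗w | a′ , a′≗w′ = cong (iter S (toℕ k)) (begin
      w k                       ≡⟨ a≗w k ⟨
      lincomb (block a k) b     ≡⟨ cong (λ x → lincomb (block x k) b) a≡a′ ⟩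
      lincomb (block a′ k) b    ≡⟨ a′≗w′ k ⟩
      w′ k                      ∎)
      where
        open ≡-Reasoning
        assemble-surjective : StrictlySurjective _≡_ assemble
        assemble-surjective v with S-spans v
        ... | u , u∈W , Σu≡v with coefficients u u∈W
        ...   | c , c≗u = c , trans (powerSum-cong S c≗u) Σu≡v
        a≡a′ : a ≡ a′
        a≡a′ = ↔Fin-surjective⇒injective Vec-Fin↔Fin^ assemble assemble-surjective
                 (trans (powerSum-cong S a≗w) (trans Σw≡Σw′ (sym (powerSum-cong S a′≗w′))))

  IsSplitting-transfer : ∀ {m d} {T S : V (m * d) → V (m * d)} → Linear T → Linear S →
                         ∀ e → (∀ x → T x ≡ S x ⊕ e · x) →
                         ∀ W → IsSplitting 𝔽 m d T W → IsSplitting 𝔽 m d S W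
  IsSplitting-transfer {d = d} {S = S} T-lin S-lin e T≡S+e W (dim@(W-sub , b , _ , b-spans , _) , T-spans , _) =
    dim , S-spans , Spans⇒Direct b b-spans S-spans
    where
      S-spans : Spans d S W
      S-spans = Spans-transfer T-lin S-lin e T≡S+e W-sub T-spans

mainTheorem13 : ∀ {q : ℕ} (𝔽 : FiniteField q) (m d : ℕ)
    (T : Vect 𝔽 (m * d) → Vect 𝔽 (m * d)) → IsLinear 𝔽 T → (c : Fin q) → (k : ℕ)
    → (σ≡ 𝔽 m d T k → σ≡ 𝔽 m d (plusScalar 𝔽 T c) k)
      × (σ≡ 𝔽 m d (plusScalar 𝔽 T c) k → σ≡ 𝔽 m d T k)
mainTheorem13 𝔽 m d T T-linear c k = HasCard-cong 𝔽 T⇒T+cI T+cI⇒T k , HasCard-cong 𝔽 T+cI⇒T T⇒T+cI k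
  where
    open FiniteField 𝔽 using (-F_)
    T+cI : Vect 𝔽 (m * d) → Vect 𝔽 (m * d)
    T+cI = plusScalar 𝔽 T c
    T+cI-linear : IsLinear 𝔽 T+cI
    T+cI-linear = plusScalar-linear 𝔽 T-linear c
    T⇒T+cI : ∀ W → IsSplitting 𝔽 m d T W → IsSplitting 𝔽 m d T+cI W
    T⇒T+cI = IsSplitting-transfer 𝔽 T-linear T+cI-linear (-F c) (plusScalar-minus 𝔽 T c)
    T+cI⇒T : ∀ W → IsSplitting 𝔽 m d T+cI W → IsSplitting 𝔽 m d T W
    T+cI⇒T = IsSplitting-transfer 𝔽 T+cI-linear T-linear c (λ _ → refl)
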